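{- Let $M\ge 2$ and $R\ge 0$ be integers. Consider the $R$-round algorithm $\mathcal{A}_R$ described in the context, run on an instance consisting of a $\mathsf{HORN\text{ - }SAT}$ instance $\Psi$ on $n$ variables together with a global constraint $\sum_{i=1}^n x_i\equiv a \pmod M$. If $\mathcal{A}_R$ fails on some such instance (i.e. it outputs NO-SOLUTION although some $x\in\{0,1\}^n$ satisfies $\Psi$ and the global constraint), then there exists an $(M,R,d)$-system for some $d\le n$.
   Context: A $\mathsf{HORN\text{ - }SAT}$ instance on Boolean variables $x_1,\dots,x_n$ is a conjunction of constraints of the forms $x_i=0$, $x_i=1$, or $x_{i_1}\vee\neg x_{i_2}\vee\cdots\vee\neg x_{i_k}$ (only the first variable unnegated). Its set of solutions is closed under coordinatewise AND, so for every $x\in\{0,1\}^n$ there is a unique coordinatewise-minimal solution $y\ge x$ of $\Psi$ if any solution $y\ge x$ exists; call it $\mathrm{FindMinimal}(x)$ (computable in polynomial time). The algorithm $\mathcal{A}_R$: for every $x\in\{0,1\}^n$ of Hamming weight at most $R$, compute $\mathrm{FindMinimal}(x)$; if some such $y$ exists and satisfies $\sum_i y_i\equiv a\pmod M$, output it; otherwise output NO-SOLUTION. A family $\mathcal F\subseteq 2^{[d]}$ is an $(M,r,d)$-system if (1) $F,G\in\mathcal F$ implies $F\cap G\in\mathcal F$; (2) $|F|\not\equiv d\pmod M$ for every $F\in\mathcal F$; (3) every $S\subseteq[d]$ with $|S|\le r$ is contained in some $F\in\mathcal F$. -}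

module Defs where

open import Data.Nat using (ℕ; _≤_)
open import Data.Integer using (ℤ; +_; _-_)
open import Data.Integer.Divisibility using (_∣_)
open import Data.Bool using (Bool; true; false)
open import Data.Fin using (Fin)
open import Data.Fin.Subset using (Subset; _∩_; _⊆_; ∣_∣)
open import Data.Vec using (lookup)
open import Data.List using (List)
open import Data.List.Relation.Unary.All using (All)
open import Data.Product using (Σ; _×_; ∃)
open import Relation.Binary.PropositionalEquality using (_≡_)
open import Relation.Nullary using (¬_)

_≡_[mod_] : ℕ → ℕ → ℕ → Set
x ≡ y [mod M ] = (+ M) ∣ ((+ x) - (+ y))

-- An assignment x ∈ {0,1}^n is a Vec Bool n = Subset n (true = 1).
-- Hamming weight = ∣ x ∣ ; coordinatewise order x ≤ y is x ⊆ y.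

data Constraint (n : ℕ) : Set where
  fix0 : Fin n → Constraint n
  fix1 : Fin n → Constraint n
  horn : Fin n → List (Fin n) → Constraint n

SatC : {n : ℕ} → Subset n → Constraint n → Set
SatC x (fix0 i) = lookup x i ≡ false
SatC x (fix1 i) = lookup x i ≡ true
SatC x (horn i js) = All (λ j → lookup x j ≡ true) js → lookup x i ≡ true

HornSAT : ℕ → Set
HornSAT n = List (Constraint n)

Sat : {n : ℕ} → HornSAT n → Subset n → Set
Sat Ψ x = All (SatC x) Ψ

IsFindMinimal : {n : ℕ} → HornSAT n → Subset n → Subset n → Set
IsFindMinimal Ψ x y = Sat Ψ y × x ⊆ y × (∀ z → Sat Ψ z → x ⊆ z → y ⊆ z)

-- A_R outputs NO-SOLUTION on (Ψ, Σ x_i ≡ a mod M): for every x of weight ≤ R,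
-- FindMinimal(x) either does not exist or has weight ≢ a (mod M).
OutputsNoSolution : (M R : ℕ) {n : ℕ} → HornSAT n → ℕ → Set
OutputsNoSolution M R Ψ a =
  ∀ x → ∣ x ∣ ≤ R → ∀ y → IsFindMinimal Ψ x y → ¬ (∣ y ∣ ≡ a [mod M ])

Satisfiable : (M : ℕ) {n : ℕ} → HornSAT n → ℕ → Set
Satisfiable M {n} Ψ a = Σ (Subset n) λ z → Sat Ψ z × (∣ z ∣ ≡ a [mod M ])

Fails : (M R : ℕ) {n : ℕ} → HornSAT n → ℕ → Set
Fails M R Ψ a = OutputsNoSolution M R Ψ a × Satisfiable M Ψ a

IsSystem : (M r d : ℕ) → (Subset d → Set) → Set
IsSystem M r d ℱ =
  (∀ F G → ℱ F → ℱ G → ℱ (F ∩ G))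
  × (∀ F → ℱ F → ¬ (∣ F ∣ ≡ d [mod M ]))
  × (∀ S → ∣ S ∣ ≤ r → Σ (Subset d) λ F → ℱ F × S ⊆ F)

-- Take a minimum-weight solution z of Ψ with ∣ z ∣ ≡ a (mod M). For each solution y ⊊ z the set
-- y ∪ ∁ z has weight ∣ y ∣ + (n − ∣ z ∣), and these sets form an (M, R, n)-system. They are closed
-- under ∩ because Horn solutions are. None has weight ≡ n, since that would give a lighter solution
-- of weight ≡ a. A set S with ∣ S ∣ ≤ R is covered by FindMinimal(S ∩ z) ∪ ∁ z, and this solution
-- is a proper subset of z because 𝒜_R rejected it.
module Submission where

open import Defs
open import Data.Nat using (ℕ; suc; _≤_; _<_; _+_; s≤s)
open import Data.Nat.Properties using (≤-refl; ≤-trans; ≤-pred; +-suc; <⇒≱; ≮⇒≥; ≤∧≢⇒<; ≤-<-trans; _<?_)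
open import Data.Nat.Induction using (<-wellFounded)
import Data.Nat.Divisibility as ℕ
open import Data.Integer as ℤ using (+_)
open import Data.Integer.Properties using (pos-+)
open import Data.Integer.Divisibility.Signed using (∣ᵤ⇒∣; ∣⇒∣ᵤ; ∣m∣n⇒∣m+n) renaming (_∣_ to _∣ˢ_)
open import Data.Integer.Tactic.RingSolver using (solve-∀)
open import Data.Bool using (true; false; _∧_)
open import Data.Bool.Properties using () renaming (_≟_ to _≟ᵇ_)
open import Data.Fin.Subset using (Subset; _∩_; _∪_; ∁; _⊆_; ∣_∣)
open import Data.Fin.Subset.Properties
open import Data.Vec using ([]; _∷_; lookup; here)
open import Data.Vec.Properties using (lookup-zipWith)
import Data.List.Relation.Unary.All as All
open import Data.Product using (Σ; _×_; _,_; proj₁; proj₂)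
open import Function using (_∘_)
open import Data.Sum using (inj₁; inj₂)
open import Induction.WellFounded using (Acc; acc)
open import Relation.Nullary using (¬_; Dec; yes; no; contradiction)
open import Relation.Nullary.Decidable using (_×-dec_; _→-dec_)
open import Relation.Unary using (Pred; Decidable)
open import Relation.Binary.PropositionalEquality

≡-mod-trans : ∀ {M x y z} → x ≡ y [mod M ] → y ≡ z [mod M ] → x ≡ z [mod M ]
≡-mod-trans {M} {x} {y} {z} x≡y y≡z =
  ∣⇒∣ᵤ (subst (+ M ∣ˢ_) (telescope (+ x) (+ y) (+ z))
    (∣m∣n⇒∣m+n (∣ᵤ⇒∣ {i = + x ℤ.- + y} x≡y) (∣ᵤ⇒∣ {i = + y ℤ.- + z} y≡z)))
  where
  telescope : ∀ a b c → (a ℤ.- b) ℤ.+ (b ℤ.- c) ≡ a ℤ.- c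
  telescope = solve-∀

≡-mod-transpose : ∀ {M p q r s} → p + r ≡ q + s → p ≡ s [mod M ] → q ≡ r [mod M ]
≡-mod-transpose {M} {p} {q} {r} {s} p+r≡q+s = subst (λ t → ℕ._∣_ M ℤ.∣ t ∣) differences-equal
  where
  open ≡-Reasoning
  sums-equal : + p ℤ.+ + r ≡ + q ℤ.+ + s
  sums-equal = trans (sym (pos-+ p r)) (trans (cong +_ p+r≡q+s) (pos-+ q s))
  add-r : ∀ a b c → a ℤ.- b ≡ (a ℤ.+ c) ℤ.- (c ℤ.+ b)
  add-r = solve-∀
  cancel-s : ∀ a b c → (a ℤ.+ c) ℤ.- (b ℤ.+ c) ≡ a ℤ.- b
  cancel-s = solve-∀
  differences-equal : + p ℤ.- + s ≡ + q ℤ.- + r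
  differences-equal = begin
    + p ℤ.- + s                   ≡⟨ add-r (+ p) (+ s) (+ r) ⟩
    (+ p ℤ.+ + r) ℤ.- (+ r ℤ.+ + s) ≡⟨ cong (ℤ._- (+ r ℤ.+ + s)) sums-equal ⟩
    (+ q ℤ.+ + s) ℤ.- (+ r ℤ.+ + s) ≡⟨ cancel-s (+ q) (+ r) (+ s) ⟩
    + q ℤ.- + r                   ∎

≡-mod? : ∀ M x y → Dec (x ≡ y [mod M ])
≡-mod? M x y = ℕ._∣?_ M _

p⊆q∧∣q∣≤∣p∣⇒q⊆p : ∀ {n} {p q : Subset n} → p ⊆ q → ∣ q ∣ ≤ ∣ p ∣ → q ⊆ p
p⊆q∧∣q∣≤∣p∣⇒q⊆p {p = []}        {[]}        _   _  ()
p⊆q∧∣q∣≤∣p∣⇒q⊆p {p = true ∷ p}  {true ∷ q}  p⊆q le = s⊆s (p⊆q∧∣q∣≤∣p∣⇒q⊆p (drop-∷-⊆ p⊆q) (≤-pred le))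
p⊆q∧∣q∣≤∣p∣⇒q⊆p {p = true ∷ p}  {false ∷ q} p⊆q le = contradiction (p⊆q here) λ ()
p⊆q∧∣q∣≤∣p∣⇒q⊆p {p = false ∷ p} {true ∷ q}  p⊆q le = contradiction le (<⇒≱ (s≤s (p⊆q⇒∣p∣≤∣q∣ (drop-∷-⊆ p⊆q))))
p⊆q∧∣q∣≤∣p∣⇒q⊆p {p = false ∷ p} {false ∷ q} p⊆q le = s⊆s (p⊆q∧∣q∣≤∣p∣⇒q⊆p (drop-∷-⊆ p⊆q) le)

p⊆q⇒∣p∪∁q∣+∣q∣≡∣p∣+n : ∀ {n} {p q : Subset n} → p ⊆ q → ∣ p ∪ ∁ q ∣ + ∣ q ∣ ≡ ∣ p ∣ + n
p⊆q⇒∣p∪∁q∣+∣q∣≡∣p∣+n {p = []}        {[]}        _ = refl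
p⊆q⇒∣p∪∁q∣+∣q∣≡∣p∣+n {p = true ∷ p}  {false ∷ q} p⊆q = contradiction (p⊆q here) λ ()
p⊆q⇒∣p∪∁q∣+∣q∣≡∣p∣+n {suc n} {true ∷ p} {true ∷ q} p⊆q =
  cong suc (trans (+-suc _ _) (trans (cong suc (p⊆q⇒∣p∪∁q∣+∣q∣≡∣p∣+n (drop-∷-⊆ p⊆q))) (sym (+-suc _ _))))
p⊆q⇒∣p∪∁q∣+∣q∣≡∣p∣+n {suc n} {false ∷ p} {true ∷ q} p⊆q =
  trans (+-suc _ _) (trans (cong suc (p⊆q⇒∣p∪∁q∣+∣q∣≡∣p∣+n (drop-∷-⊆ p⊆q))) (sym (+-suc _ _)))
p⊆q⇒∣p∪∁q∣+∣q∣≡∣p∣+n {suc n} {false ∷ p} {false ∷ q} p⊆q =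
  trans (cong suc (p⊆q⇒∣p∪∁q∣+∣q∣≡∣p∣+n (drop-∷-⊆ p⊆q))) (sym (+-suc _ _))

module _ {n ℓ} {P : Pred (Subset n) ℓ} where

  MinimumWeight : Subset n → Set ℓ
  MinimumWeight w = P w × (∀ u → P u → ∣ w ∣ ≤ ∣ u ∣)

  minimumWeight : Decidable P → ∀ {y} → P y → Σ (Subset n) MinimumWeight
  minimumWeight P? {y} Py = descend y (<-wellFounded ∣ y ∣) Py
    where
    descend : ∀ y → Acc _<_ ∣ y ∣ → P y → Σ (Subset n) MinimumWeight
    descend y (acc lighter) Py with anySubset? (λ u → P? u ×-dec (∣ u ∣ <? ∣ y ∣))
    ... | yes (u , Pu , u<y) = descend u (lighter u<y) Pu
    ... | no  ∄lighter       = y , Py , λ u Pu → ≮⇒≥ (λ u<y → ∄lighter (u , Pu , u<y))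

  minimumWeight-least : (∀ {u v} → P u → P v → P (u ∩ v)) →
                        ∀ {w} → MinimumWeight w → ∀ {u} → P u → w ⊆ u
  minimumWeight-least ∩-closed {w} (Pw , w-min) {u} Pu =
    ⊆-trans (p⊆q∧∣q∣≤∣p∣⇒q⊆p (p∩q⊆p w u) (w-min (w ∩ u) (∩-closed Pw Pu))) (p∩q⊆q w u)

∧≡true⇒both : ∀ {b c} → b ∧ c ≡ true → b ≡ true × c ≡ true
∧≡true⇒both {true} {true} _ = refl , refl

module _ {n} (x y : Subset n) where

  lookup-∩ : ∀ i → lookup (x ∩ y) i ≡ lookup x i ∧ lookup y i
  lookup-∩ i = lookup-zipWith _∧_ i x y

  satC-∩ : ∀ c → SatC x c → SatC y c → SatC (x ∩ y) c
  satC-∩ (fix0 i)    x⊨c _   rewrite lookup-∩ i | x⊨c = refl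
  satC-∩ (fix1 i)    x⊨c y⊨c rewrite lookup-∩ i | x⊨c | y⊨c = refl
  satC-∩ (horn i js) x⊨c y⊨c body rewrite lookup-∩ i =
    cong₂ _∧_ (x⊨c (All.map (λ {j} → proj₁ ∘ split j) body))
              (y⊨c (All.map (λ {j} → proj₂ ∘ split j) body))
    where
    split : ∀ j → lookup (x ∩ y) j ≡ true → lookup x j ≡ true × lookup y j ≡ true
    split j = ∧≡true⇒both ∘ trans (sym (lookup-∩ j))

sat-∩ : ∀ {n} (Ψ : HornSAT n) {x y : Subset n} → Sat Ψ x → Sat Ψ y → Sat Ψ (x ∩ y)
sat-∩ Ψ {x} {y} x⊨Ψ y⊨Ψ = All.zipWith (λ {c} (x⊨c , y⊨c) → satC-∩ x y c x⊨c y⊨c) (x⊨Ψ , y⊨Ψ)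

satC? : ∀ {n} (x : Subset n) c → Dec (SatC x c)
satC? x (fix0 i)    = lookup x i ≟ᵇ false
satC? x (fix1 i)    = lookup x i ≟ᵇ true
satC? x (horn i js) = All.all? (λ j → lookup x j ≟ᵇ true) js →-dec (lookup x i ≟ᵇ true)

sat? : ∀ {n} (Ψ : HornSAT n) → Decidable (Sat Ψ)
sat? Ψ x = All.all? (satC? x) Ψ

findMinimal : ∀ {n} (Ψ : HornSAT n) {x z} → Sat Ψ z → x ⊆ z → Σ (Subset n) (IsFindMinimal Ψ x)
findMinimal Ψ {x} z⊨Ψ x⊆z with minimumWeight (λ u → sat? Ψ u ×-dec (x ⊆? u)) (z⊨Ψ , x⊆z)
... | w , min@((w⊨Ψ , x⊆w) , _) = w , w⊨Ψ , x⊆w , λ u u⊨Ψ x⊆u → minimumWeight-least ∩-closed min (u⊨Ψ , x⊆u)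
  where
  ∩-closed : ∀ {u v} → Sat Ψ u × x ⊆ u → Sat Ψ v × x ⊆ v → Sat Ψ (u ∩ v) × x ⊆ u ∩ v
  ∩-closed (u⊨Ψ , x⊆u) (v⊨Ψ , x⊆v) = sat-∩ Ψ u⊨Ψ v⊨Ψ , λ i∈x → x∈p∩q⁺ (x⊆u i∈x , x⊆v i∈x)

module _ {n} (Ψ : HornSAT n) (z : Subset n) where

  LiftedSubsolution : Subset n → Set
  LiftedSubsolution F = Σ (Subset n) λ y → Sat Ψ y × y ⊆ z × ∣ y ∣ < ∣ z ∣ × F ≡ y ∪ ∁ z

  liftedSubsolution-∩ : ∀ F G → LiftedSubsolution F → LiftedSubsolution G → LiftedSubsolution (F ∩ G)
  liftedSubsolution-∩ _ _ (y , y⊨Ψ , y⊆z , y<z , refl) (y′ , y′⊨Ψ , _ , _ , refl) =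
    y ∩ y′ , sat-∩ Ψ y⊨Ψ y′⊨Ψ , ⊆-trans (p∩q⊆p y y′) y⊆z ,
    ≤-<-trans (∣p∩q∣≤∣p∣ y y′) y<z , sym (∪-distribʳ-∩ (∁ z) y y′)

  liftedSubsolution-weight : ∀ {M a} → MinimumWeight {P = λ y → Sat Ψ y × ∣ y ∣ ≡ a [mod M ]} z →
                             ∀ F → LiftedSubsolution F → ¬ (∣ F ∣ ≡ n [mod M ])
  liftedSubsolution-weight {M} {a} ((_ , z≡a) , z-min) _ (y , y⊨Ψ , y⊆z , y<z , refl) F≡n =
    <⇒≱ y<z (z-min y (y⊨Ψ , ≡-mod-trans {M} {∣ y ∣} {∣ z ∣} {a} y≡z z≡a))
    where
    y≡z : ∣ y ∣ ≡ ∣ z ∣ [mod M ]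
    y≡z = ≡-mod-transpose {M} {∣ y ∪ ∁ z ∣} {∣ y ∣} {∣ z ∣} {n} (p⊆q⇒∣p∪∁q∣+∣q∣≡∣p∣+n y⊆z) F≡n

  liftedSubsolution-cover : ∀ {M R a} → OutputsNoSolution M R Ψ a → Sat Ψ z → ∣ z ∣ ≡ a [mod M ] →
                            ∀ S → ∣ S ∣ ≤ R → Σ (Subset n) λ F → LiftedSubsolution F × S ⊆ F
  liftedSubsolution-cover {M} {R} {a} rejects z⊨Ψ z≡a S ∣S∣≤R with findMinimal Ψ z⊨Ψ (p∩q⊆q S z)
  ... | w , fm@(w⊨Ψ , S∩z⊆w , w-least) = w ∪ ∁ z , (w , w⊨Ψ , w⊆z , w<z , refl) , S⊆w∪∁z
    where
    w⊆z : w ⊆ z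
    w⊆z = w-least z z⊨Ψ (p∩q⊆q S z)
    w<z : ∣ w ∣ < ∣ z ∣
    w<z = ≤∧≢⇒< (p⊆q⇒∣p∣≤∣q∣ w⊆z) λ w≡z →
      rejects (S ∩ z) (≤-trans (∣p∩q∣≤∣p∣ S z) ∣S∣≤R) w fm (subst (_≡ a [mod M ]) (sym w≡z) z≡a)
    S⊆w∪∁z : S ⊆ w ∪ ∁ z
    S⊆w∪∁z {i} i∈S with i ∈? z
    ... | yes i∈z = x∈p∪q⁺ (inj₁ (S∩z⊆w (x∈p∩q⁺ (i∈S , i∈z))))
    ... | no  i∉z = x∈p∪q⁺ (inj₂ (x∉p⇒x∈∁p i∉z))

proposition3p3 : (M R : ℕ) → 2 ≤ M → (n : ℕ) → (Ψ : HornSAT n) → (a : ℕ) → Fails M R Ψ a → Σ ℕ λ d → d ≤ n × Σ (Subset d → Set) λ ℱ → IsSystem M R d ℱ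
proposition3p3 M R _ n Ψ a (rejects , solution) with minimumWeight (λ y → sat? Ψ y ×-dec ≡-mod? M ∣ y ∣ a) (proj₂ solution)
... | z , min@((z⊨Ψ , z≡a) , _) =
  n , ≤-refl , LiftedSubsolution Ψ z ,
  liftedSubsolution-∩ Ψ z ,
  liftedSubsolution-weight Ψ z {M} {a} min ,
  liftedSubsolution-cover Ψ z {M} {R} {a} rejects z⊨Ψ z≡a
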